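{- Let $G$ be a finite abelian group and $S\subseteq G\setminus\{0\}$ an inverse-closed generating set of $G$ with $|S|=5$. If $\mathrm{Cay}(G,S)$ admits a perfect code, then $S$ contains exactly one involution.
   Context: $\mathrm{Cay}(G,S)$ has vertex set $G$ with $x\sim y$ iff $y-x\in S$. A perfect code is a vertex set $C$ such that every vertex is at distance at most $1$ from exactly one vertex of $C$. An involution is an element of order $2$. -}

module Defs where

open import Level using (Level)
open import Data.Nat using (ℕ)
open import Data.Fin using (Fin)
open import Data.Product using (Σ; ∃; ∃-syntax; _×_; _,_)
open import Relation.Nullary using (¬_)
open import Relation.Binary.PropositionalEquality using (_≡_)
open import Algebra.Bundles using (AbelianGroup)

module _ {c ℓ : Level} (G : AbelianGroup c ℓ) where
  open AbelianGroup G renaming (Carrier to A)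

  IsFiniteGroup : Set (c Level.⊔ ℓ)
  IsFiniteGroup = ∃[ n ] Σ (Fin n → A) λ e →
    (∀ x → ∃[ i ] (e i ≈ x)) × (∀ i j → e i ≈ e j → i ≡ j)

  -- A connection set S = {s 0,…,s (k-1)} given as k pairwise distinct elements,
  -- so that |S| = k.
  Distinct : {k : ℕ} → (Fin k → A) → Set (ℓ)
  Distinct s = ∀ i j → s i ≈ s j → i ≡ j

  _∈S_ : {k : ℕ} → A → (Fin k → A) → Set ℓ
  x ∈S s = ∃[ i ] (x ≈ s i)

  ExcludesZero : {k : ℕ} → (Fin k → A) → Set ℓ
  ExcludesZero s = ∀ i → ¬ (s i ≈ ε)

  InverseClosed : {k : ℕ} → (Fin k → A) → Set ℓ
  InverseClosed s = ∀ i → (s i ⁻¹) ∈S s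

  data InSpan {k : ℕ} (s : Fin k → A) : A → Set (c Level.⊔ ℓ) where
    gen   : ∀ i → InSpan s (s i)
    unit  : InSpan s ε
    inv   : ∀ {x} → InSpan s x → InSpan s (x ⁻¹)
    mul   : ∀ {x y} → InSpan s x → InSpan s y → InSpan s (x ∙ y)
    resp  : ∀ {x y} → x ≈ y → InSpan s x → InSpan s y

  Generates : {k : ℕ} → (Fin k → A) → Set (c Level.⊔ ℓ)
  Generates s = ∀ x → InSpan s x

  Adj : {k : ℕ} → (Fin k → A) → A → A → Set ℓ
  Adj s x y = (y ∙ x ⁻¹) ∈S s

  Dist≤1 : {k : ℕ} → (Fin k → A) → A → A → Set ℓ
  Dist≤1 s c x = (c ≈ x) Data.Sum.⊎ Adj s c x
    where import Data.Sum

  IsPerfectCode : ∀ {p} {k : ℕ} → (Fin k → A) → (A → Set p) → Set (c Level.⊔ ℓ Level.⊔ p)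
  IsPerfectCode s C = ∀ x → ∃[ c ] (C c × Dist≤1 s c x ×
                        (∀ c′ → C c′ → Dist≤1 s c′ x → c′ ≈ c))

  IsInvolution : A → Set ℓ
  IsInvolution x = ¬ (x ≈ ε) × (x ∙ x ≈ ε)

{-# OPTIONS --safe #-}
-- Inversion permutes the five elements of S, so S contains an odd number of involutions and it
-- suffices to exclude three of them, a, b and c. Every x is uniquely w + t with w in the code C
-- and t ∈ S ∪ {0}; call t the offset of x. Two consequences drive the argument: y + h₁ and y + h₂
-- with equal offsets force h₁ = h₂, and for a codeword z the offset of z + a + b lies outside
-- {0, a, b}. If that offset is c, pick u ∈ S ∖ {a, b, c}: the offsets of z + a + u and z + b + u
-- both avoid {0, a, b, c, u}, so both equal the fifth element of S, whence a = b. Otherwise the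
-- offsets of z + a + b, z + a + c and z + b + c lie in the two-element set S ∖ {a, b, c}, and two
-- equal offsets again identify two of a, b, c.
module Submission where

open import Defs
open import Level using (Level; 0ℓ)
open import Algebra.Bundles using (AbelianGroup)
open import Data.Nat using (ℕ)
open import Data.Fin using (Fin; zero; suc)
open import Data.Fin.Properties using (all?; any?; _≟_)
open import Data.Vec using (lookup; tabulate; _∷_; [])
open import Data.Vec.Properties using (lookup∘tabulate)
open import Data.Product using (∃-syntax; _×_; _,_; proj₁; proj₂)
open import Data.Sum using (_⊎_; inj₁; inj₂; [_,_])
import Data.Sum as Sum
open import Data.Empty using (⊥; ⊥-elim)
open import Function using (_∘_)
open import Relation.Nullary using (¬_; Dec; yes; no)
open import Relation.Nullary.Decidable using (_×-dec_; _⊎-dec_; _→-dec_; ¬?; toWitness)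
open import Relation.Binary.PropositionalEquality as ≡ using (_≡_; _≢_; _≗_)

Involutive : ∀ {n} → (Fin n → Fin n) → Set
Involutive σ = ∀ i → σ (σ i) ≡ i

UniqueFixedPoint : ∀ {n} → (Fin n → Fin n) → Set
UniqueFixedPoint σ = ∃[ p ] (σ p ≡ p × ∀ j → σ j ≡ j → j ≡ p)

ThreeFixedPoints : ∀ {n} → (Fin n → Fin n) → Set
ThreeFixedPoints σ =
  ∃[ p ] ∃[ q ] ∃[ r ] (σ p ≡ p × σ q ≡ q × σ r ≡ r × p ≢ q × p ≢ r × q ≢ r)

involutive? : ∀ {n} (σ : Fin n → Fin n) → Dec (Involutive σ)
involutive? σ = all? λ i → σ (σ i) ≟ i

uniqueFixedPoint? : ∀ {n} (σ : Fin n → Fin n) → Dec (UniqueFixedPoint σ)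
uniqueFixedPoint? σ = any? λ p → (σ p ≟ p) ×-dec all? λ j → σ j ≟ j →-dec j ≟ p

threeFixedPoints? : ∀ {n} (σ : Fin n → Fin n) → Dec (ThreeFixedPoints σ)
threeFixedPoints? σ = any? λ p → any? λ q → any? λ r →
  (σ p ≟ p) ×-dec (σ q ≟ q) ×-dec (σ r ≟ r) ×-dec ¬? (p ≟ q) ×-dec ¬? (p ≟ r) ×-dec ¬? (q ≟ r)

module _ {n} {σ τ : Fin n → Fin n} (σ≗τ : σ ≗ τ) where

  involutive-resp-≗ : Involutive σ → Involutive τ
  involutive-resp-≗ σ-inv i = ≡.trans (≡.sym (≡.trans (σ≗τ (σ i)) (≡.cong τ (σ≗τ i)))) (σ-inv i)

  fixed-resp-≗ : ∀ {i} → σ i ≡ i → τ i ≡ i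
  fixed-resp-≗ {i} = ≡.trans (≡.sym (σ≗τ i))

  uniqueFixedPoint-resp-≗ : UniqueFixedPoint σ → UniqueFixedPoint τ
  uniqueFixedPoint-resp-≗ (p , fp , unique) = p , fixed-resp-≗ fp , λ j fj → unique j (≡.trans (σ≗τ j) fj)

  threeFixedPoints-resp-≗ : ThreeFixedPoints σ → ThreeFixedPoints τ
  threeFixedPoints-resp-≗ (p , q , r , fp , fq , fr , distinct) =
    p , q , r , fixed-resp-≗ fp , fixed-resp-≗ fq , fixed-resp-≗ fr , distinct

-- An involution of a set of odd size has an odd number of fixed points; here checked on all 5⁵ maps.
involution-fixedPoints : (σ : Fin 5 → Fin 5) → Involutive σ → UniqueFixedPoint σ ⊎ ThreeFixedPoints σ
involution-fixedPoints σ σ-inv =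
  Sum.map (uniqueFixedPoint-resp-≗ σ≗) (threeFixedPoints-resp-≗ σ≗)
    (table (involutive-resp-≗ (≡.sym ∘ σ≗) σ-inv))
  where
  σ≗ : lookup (tabulate σ) ≗ σ
  σ≗ = lookup∘tabulate σ
  table : let τ = lookup (tabulate σ) in Involutive τ → UniqueFixedPoint τ ⊎ ThreeFixedPoints τ
  table = toWitness {a? = all? λ x₀ → all? λ x₁ → all? λ x₂ → all? λ x₃ → all? λ x₄ →
    let τ = lookup (x₀ ∷ x₁ ∷ x₂ ∷ x₃ ∷ x₄ ∷ []) in
    involutive? τ →-dec (uniqueFixedPoint? τ ⊎-dec threeFixedPoints? τ)} _
      (σ zero) (σ (suc zero)) (σ (suc (suc zero))) (σ (suc (suc (suc zero)))) (σ (suc (suc (suc (suc zero)))))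

Outside : ∀ {n} → Fin n → Fin n → Fin n → Fin n → Set
Outside p q r i = i ≢ p × i ≢ q × i ≢ r

outside? : ∀ {n} (p q r i : Fin n) → Dec (Outside p q r i)
outside? p q r i = ¬? (i ≟ p) ×-dec ¬? (i ≟ q) ×-dec ¬? (i ≟ r)

-- Opaque, so that case analysis on these facts does not unfold the exhaustive search.
opaque
  avoid-three : (p q r : Fin 5) → ∃[ u ] Outside p q r u
  avoid-three = toWitness {a? = all? λ p → all? λ q → all? λ r → any? (outside? p q r)} _

  pigeonhole-outside-three : ∀ {p q r i j k : Fin 5} → p ≢ q → p ≢ r → q ≢ r →
    Outside p q r i → Outside p q r j → Outside p q r k → i ≡ j ⊎ i ≡ k ⊎ j ≡ k
  pigeonhole-outside-three {p} {q} {r} {i} {j} {k} p≢q p≢r q≢r =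
    toWitness {a? = all? λ p → all? λ q → all? λ r → ¬? (p ≟ q) →-dec ¬? (p ≟ r) →-dec ¬? (q ≟ r) →-dec
      all? λ i → all? λ j → all? λ k → outside? p q r i →-dec outside? p q r j →-dec outside? p q r k →-dec
      ((i ≟ j) ⊎-dec (i ≟ k) ⊎-dec (j ≟ k))} _ p q r p≢q p≢r q≢r i j k

module SelfInverse {c ℓ : Level} (G : AbelianGroup c ℓ) where
  open AbelianGroup G
  open import Algebra.Properties.Monoid monoid using (insertʳ; cancelʳ)
  open import Algebra.Properties.CommutativeSemigroup commutativeSemigroup using (xy∙z≈xz∙y)
  open import Relation.Binary.Reasoning.Setoid setoid

  move-selfInverse : ∀ {g x y} → g ∙ g ≈ ε → x ∙ g ≈ y → x ≈ y ∙ g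
  move-selfInverse {g} {x} gg e = trans (insertʳ gg x) (∙-congʳ e)

  swap-selfInverse : ∀ {h k y w} → h ∙ h ≈ ε → k ∙ k ≈ ε → y ∙ h ≈ w ∙ k → y ∙ k ≈ w ∙ h
  swap-selfInverse {h} {k} {y} {w} hh kk e = begin
    y ∙ k          ≈⟨ ∙-congʳ (move-selfInverse hh e) ⟩
    w ∙ k ∙ h ∙ k  ≈⟨ ∙-congʳ (xy∙z≈xz∙y w k h) ⟩
    w ∙ h ∙ k ∙ k  ≈⟨ cancelʳ kk (w ∙ h) ⟩
    w ∙ h          ∎

module InverseIndex {c ℓ : Level} (G : AbelianGroup c ℓ) {k : ℕ} (s : Fin k → AbelianGroup.Carrier G)
  (distinct : Distinct G s) (closed : InverseClosed G s) where
  open AbelianGroup G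
  open import Algebra.Properties.AbelianGroup G using (⁻¹-involutive; inverseˡ-unique)

  inverseIndex : Fin k → Fin k
  inverseIndex i = proj₁ (closed i)

  s-inverseIndex : ∀ i → s i ⁻¹ ≈ s (inverseIndex i)
  s-inverseIndex i = proj₂ (closed i)

  inverseIndex-involutive : Involutive inverseIndex
  inverseIndex-involutive i = distinct _ _
    (trans (sym (s-inverseIndex (inverseIndex i)))
      (trans (⁻¹-cong (sym (s-inverseIndex i))) (⁻¹-involutive (s i))))

  fixed⇒selfInverse : ∀ {i} → inverseIndex i ≡ i → s i ∙ s i ≈ ε
  fixed⇒selfInverse {i} fi =
    trans (∙-congˡ (sym (trans (s-inverseIndex i) (reflexive (≡.cong s fi))))) (inverseʳ (s i))

  selfInverse⇒fixed : ∀ {i} → s i ∙ s i ≈ ε → inverseIndex i ≡ i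
  selfInverse⇒fixed {i} ii = distinct _ _ (trans (sym (s-inverseIndex i)) (sym (inverseˡ-unique (s i) (s i) ii)))

module PerfectCode {c ℓ a : Level} (G : AbelianGroup c ℓ) {k : ℕ} (s : Fin k → AbelianGroup.Carrier G)
  (C : AbelianGroup.Carrier G → Set a) (code : IsPerfectCode G s C) where
  open AbelianGroup G renaming (Carrier to A)
  open import Algebra.Properties.AbelianGroup G using (∙-cancelˡ; ∙-cancelʳ; xyx⁻¹≈y)
  open import Algebra.Properties.Monoid monoid using (insertʳ; elimʳ)
  open import Algebra.Properties.CommutativeSemigroup commutativeSemigroup using (xy∙z≈xz∙y)
  open import Relation.Binary.Reasoning.Setoid setoid
  open SelfInverse G

  UnitBall : A → Set ℓ
  UnitBall t = t ≈ ε ⊎ ∃[ i ] (t ≈ s i)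

  member : ∀ i → UnitBall (s i)
  member i = inj₂ (i , refl)

  dist≤1⇒offset : ∀ {w x} → Dist≤1 G s w x → ∃[ t ] (UnitBall t × x ≈ w ∙ t)
  dist≤1⇒offset {w} (inj₁ w≈x) = ε , inj₁ refl , trans (sym w≈x) (sym (identityʳ w))
  dist≤1⇒offset {w} {x} (inj₂ (i , e)) = s i , member i , (begin
    x              ≈⟨ insertʳ (inverseˡ w) x ⟩
    x ∙ w ⁻¹ ∙ w   ≈⟨ ∙-congʳ e ⟩
    s i ∙ w        ≈⟨ comm (s i) w ⟩
    w ∙ s i        ∎)

  offset⇒dist≤1 : ∀ {w x t} → UnitBall t → x ≈ w ∙ t → Dist≤1 G s w x
  offset⇒dist≤1 {w} (inj₁ t≈ε) e = inj₁ (sym (trans e (elimʳ t≈ε w)))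
  offset⇒dist≤1 {w} {x} {t} (inj₂ (i , t≈sᵢ)) e = inj₂ (i , (begin
    x ∙ w ⁻¹       ≈⟨ ∙-congʳ e ⟩
    w ∙ t ∙ w ⁻¹   ≈⟨ xyx⁻¹≈y w t ⟩
    t              ≈⟨ t≈sᵢ ⟩
    s i            ∎))

  cover : ∀ x → ∃[ w ] (C w × ∃[ t ] (UnitBall t × x ≈ w ∙ t))
  cover x = let w , Cw , near , _ = code x in w , Cw , dist≤1⇒offset near

  offset-unique : ∀ {w₁ w₂ t₁ t₂} → C w₁ → C w₂ → UnitBall t₁ → UnitBall t₂ →
    w₁ ∙ t₁ ≈ w₂ ∙ t₂ → t₁ ≈ t₂
  offset-unique {w₁} {w₂} {t₁} {t₂} C₁ C₂ B₁ B₂ e = ∙-cancelˡ w₁ t₁ t₂ (trans e (∙-congʳ w₂≈w₁))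
    where
    unique = proj₂ (proj₂ (proj₂ (code (w₁ ∙ t₁))))
    w₂≈w₁ : w₂ ≈ w₁
    w₂≈w₁ = trans (unique w₂ C₂ (offset⇒dist≤1 B₂ e))
                  (sym (unique w₁ C₁ (offset⇒dist≤1 B₁ refl)))

  cancel⇒≈ε : ∀ {z w g h} → C z → C w → UnitBall g → z ∙ g ∙ h ≈ w ∙ h → g ≈ ε
  cancel⇒≈ε {w = w} Cz Cw Bg e =
    offset-unique Cz Cw Bg (inj₁ refl) (trans (∙-cancelʳ _ _ _ e) (sym (identityʳ w)))

  selfInverse-collapse : ∀ {z w g h} → C z → C w → UnitBall g → UnitBall h →
    h ∙ h ≈ ε → z ∙ g ∙ h ≈ w → g ≈ h
  selfInverse-collapse Cz Cw Bg Bh hh e = offset-unique Cz Cw Bg Bh (move-selfInverse hh e)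

  common-offset-unique : ∀ {y w₁ w₂ h₁ h₂ t} → C w₁ → C w₂ → UnitBall h₁ → UnitBall h₂ →
    y ∙ h₁ ≈ w₁ ∙ t → y ∙ h₂ ≈ w₂ ∙ t → h₁ ≈ h₂
  common-offset-unique {y} {w₁} {w₂} {h₁} {h₂} {t} C₁ C₂ B₁ B₂ e₁ e₂ =
    sym (offset-unique C₁ C₂ B₂ B₁ (∙-cancelʳ t _ _ (begin
      w₁ ∙ h₂ ∙ t  ≈⟨ xy∙z≈xz∙y w₁ h₂ t ⟩
      w₁ ∙ t ∙ h₂  ≈⟨ ∙-congʳ e₁ ⟨
      y ∙ h₁ ∙ h₂  ≈⟨ xy∙z≈xz∙y y h₁ h₂ ⟩
      y ∙ h₂ ∙ h₁  ≈⟨ ∙-congʳ e₂ ⟩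
      w₂ ∙ t ∙ h₁  ≈⟨ xy∙z≈xz∙y w₂ t h₁ ⟩
      w₂ ∙ h₁ ∙ t  ∎)))

  module _ (distinct : Distinct G s) (nonzero : ExcludesZero G s) where

    pair-sum-offset : ∀ {z p q} → C z → p ≢ q → s p ∙ s p ≈ ε → s q ∙ s q ≈ ε →
      ∃[ w ] ∃[ i ] (C w × i ≢ p × i ≢ q × z ∙ s p ∙ s q ≈ w ∙ s i)
    pair-sum-offset {z} {p} {q} Cz p≢q pp qq with cover (z ∙ s p ∙ s q)
    ... | w , Cw , t , inj₁ t≈ε , e =
      ⊥-elim (p≢q (distinct p q (selfInverse-collapse Cz Cw (member p) (member q) qq (trans e (elimʳ t≈ε w)))))
    ... | w , Cw , t , inj₂ (i , t≈sᵢ) , e with trans e (∙-congˡ t≈sᵢ) | i ≟ p | i ≟ q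
    ...   | e′ | yes ≡.refl | _ =
      ⊥-elim (nonzero q (cancel⇒≈ε Cz Cw (member q) (trans (xy∙z≈xz∙y z (s q) (s p)) e′)))
    ...   | e′ | no _ | yes ≡.refl = ⊥-elim (nonzero p (cancel⇒≈ε Cz Cw (member p) e′))
    ...   | e′ | no i≢p | no i≢q = w , i , Cw , i≢p , i≢q , e′

    mixed-sum-offset : ∀ {z W p q r u} → C z → C W → u ≢ p → u ≢ q → u ≢ r →
      s p ∙ s p ≈ ε → s q ∙ s q ≈ ε → s r ∙ s r ≈ ε → z ∙ s p ∙ s q ≈ W ∙ s r →
      ∃[ w ] ∃[ j ] (C w × j ≢ p × j ≢ q × j ≢ r × j ≢ u × z ∙ s p ∙ s u ≈ w ∙ s j)
    mixed-sum-offset {z} {W} {p} {q} {r} {u} Cz CW u≢p u≢q u≢r pp qq rr hW with cover (z ∙ s p ∙ s u)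
    ... | w , Cw , t , inj₁ t≈ε , e = ⊥-elim (u≢p (distinct u p
      (selfInverse-collapse Cz Cw (member u) (member p) pp
        (trans (xy∙z≈xz∙y z (s u) (s p)) (trans e (elimʳ t≈ε w))))))
    ... | w , Cw , t , inj₂ (j , t≈sⱼ) , e
      with trans e (∙-congˡ t≈sⱼ) | j ≟ p | j ≟ q | j ≟ r | j ≟ u
    ...   | e′ | yes ≡.refl | _ | _ | _ =
      ⊥-elim (nonzero u (cancel⇒≈ε Cz Cw (member u) (trans (xy∙z≈xz∙y z (s u) (s p)) e′)))
    ...   | e′ | no _ | yes ≡.refl | _ | _ =
      ⊥-elim (u≢r (distinct u r (common-offset-unique Cw CW (member u) (member r) e′ (swap-selfInverse qq rr hW))))
    ...   | e′ | no _ | no _ | yes ≡.refl | _ =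
      ⊥-elim (u≢q (distinct u q (common-offset-unique Cw CW (member u) (member q) e′ hW)))
    ...   | e′ | no _ | no _ | no _ | yes ≡.refl = ⊥-elim (nonzero p (cancel⇒≈ε Cz Cw (member p) e′))
    ...   | e′ | no j≢p | no j≢q | no j≢r | no j≢u = w , j , Cw , j≢p , j≢q , j≢r , j≢u , e′

module FiveElementConnectionSet {c ℓ a : Level} (G : AbelianGroup c ℓ) (s : Fin 5 → AbelianGroup.Carrier G)
  (distinct : Distinct G s) (nonzero : ExcludesZero G s)
  (C : AbelianGroup.Carrier G → Set a) (code : IsPerfectCode G s C) where
  open AbelianGroup G
  open import Algebra.Properties.CommutativeSemigroup commutativeSemigroup using (xy∙z≈xz∙y)
  open SelfInverse G
  open PerfectCode G s C code

  module _ {z p q r} (Cz : C z) (p≢q : p ≢ q) (p≢r : p ≢ r) (q≢r : q ≢ r)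
    (pp : s p ∙ s p ≈ ε) (qq : s q ∙ s q ≈ ε) (rr : s r ∙ s r ≈ ε) where

    pair-sum-offset-not-selfInverse : ∀ {W} → C W → ¬ (z ∙ s p ∙ s q ≈ W ∙ s r)
    pair-sum-offset-not-selfInverse CW hW with avoid-three p q r
    ... | u , u≢p , u≢q , u≢r
      with mixed-sum-offset distinct nonzero Cz CW u≢p u≢q u≢r pp qq rr hW
         | mixed-sum-offset distinct nonzero Cz CW u≢q u≢p u≢r qq pp rr (trans (xy∙z≈xz∙y z (s q) (s p)) hW)
    ... | w₁ , j₁ , C₁ , j₁≢p , j₁≢q , j₁≢r , j₁≢u , e₁
        | w₂ , j₂ , C₂ , j₂≢q , j₂≢p , j₂≢r , j₂≢u , e₂
      with pigeonhole-outside-three p≢q p≢r q≢r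
             (j₁≢p , j₁≢q , j₁≢r) (j₂≢p , j₂≢q , j₂≢r) (u≢p , u≢q , u≢r)
    ... | inj₁ ≡.refl = p≢q (distinct p q (common-offset-unique C₁ C₂ (member p) (member q)
            (trans (xy∙z≈xz∙y z (s u) (s p)) e₁) (trans (xy∙z≈xz∙y z (s u) (s q)) e₂)))
    ... | inj₂ (inj₁ j₁≡u) = j₁≢u j₁≡u
    ... | inj₂ (inj₂ j₂≡u) = j₂≢u j₂≡u

    no-three-selfInverse : ⊥
    no-three-selfInverse
      with pair-sum-offset distinct nonzero Cz p≢q pp qq
         | pair-sum-offset distinct nonzero Cz p≢r pp rr
         | pair-sum-offset distinct nonzero Cz q≢r qq rr
    ... | w₁ , i₁ , C₁ , i₁≢p , i₁≢q , e₁
        | w₂ , i₂ , C₂ , i₂≢p , i₂≢r , e₂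
        | w₃ , i₃ , C₃ , i₃≢q , i₃≢r , e₃
      with i₁ ≟ r | i₂ ≟ q | i₃ ≟ p
    ... | yes ≡.refl | _ | _ = pair-sum-offset-not-selfInverse C₁ e₁
    ... | no _ | yes ≡.refl | _ = pair-sum-offset-not-selfInverse C₂ (swap-selfInverse rr qq e₂)
    ... | no _ | no _ | yes ≡.refl =
      pair-sum-offset-not-selfInverse C₃ (trans (xy∙z≈xz∙y z (s p) (s q)) (swap-selfInverse rr pp e₃))
    ... | no i₁≢r | no i₂≢q | no i₃≢p
      with pigeonhole-outside-three p≢q p≢r q≢r
             (i₁≢p , i₁≢q , i₁≢r) (i₂≢p , i₂≢q , i₂≢r) (i₃≢p , i₃≢q , i₃≢r)
    ...   | inj₁ ≡.refl = q≢r (distinct q r (common-offset-unique C₁ C₂ (member q) (member r) e₁ e₂))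
    ...   | inj₂ (inj₁ ≡.refl) = p≢r (distinct p r (common-offset-unique C₁ C₃ (member p) (member r)
              (trans (xy∙z≈xz∙y z (s q) (s p)) e₁) e₃))
    ...   | inj₂ (inj₂ ≡.refl) = p≢q (distinct p q (common-offset-unique C₂ C₃ (member p) (member q)
              (trans (xy∙z≈xz∙y z (s r) (s p)) e₂) (trans (xy∙z≈xz∙y z (s r) (s q)) e₃)))

lemma3p1 : {c ℓ : Level} (G : AbelianGroup c ℓ) → IsFiniteGroup G →
    (s : Fin 5 → AbelianGroup.Carrier G) → Distinct G s → ExcludesZero G s →
    InverseClosed G s → Generates G s →
    (∃[ C ] IsPerfectCode G {p = 0ℓ} s C) →
    ∃[ i ] (IsInvolution G (s i) × (∀ j → IsInvolution G (s j) → j ≡ i))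
lemma3p1 G _ s distinct nonzero closed _ (C , code) =
  [ unique-involution , ⊥-elim ∘ no-three-involutions ]
    (involution-fixedPoints inverseIndex inverseIndex-involutive)
  where
  open AbelianGroup G using (ε)
  open InverseIndex G s distinct closed
  open FiveElementConnectionSet G s distinct nonzero C code

  unique-involution : UniqueFixedPoint inverseIndex →
    ∃[ i ] (IsInvolution G (s i) × (∀ j → IsInvolution G (s j) → j ≡ i))
  unique-involution (p , fp , unique) =
    p , (nonzero p , fixed⇒selfInverse fp) , λ j (_ , jj) → unique j (selfInverse⇒fixed jj)

  no-three-involutions : ThreeFixedPoints inverseIndex → ⊥
  no-three-involutions (p , q , r , fp , fq , fr , p≢q , p≢r , q≢r) =
    no-three-selfInverse (proj₁ (proj₂ (code ε))) p≢q p≢r q≢r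
      (fixed⇒selfInverse fp) (fixed⇒selfInverse fq) (fixed⇒selfInverse fr)
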